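{- Let $n\geq 4$ be an integer and $S(n)=\langle f_n^2,f_{n+1}^2,f_{n+2}^2\rangle$, and let $\mathrm{F}(S(n))$ be its Frobenius number. (1) If $f_n$ is even (that is, $n=3k$ with $k\geq 2$), then $\mathrm{F}(S(n)) = \left(\frac{f_{n+3}}{2}-1\right)f_{n+1}^2 + (f_{n-2}-1)f_{n+2}^2 - f_n^2$. (2) If $f_{n+1}$ is even (that is, $n=3k-1$ with $k\geq 2$), then $\mathrm{F}(S(n)) = (f_{n+2}-1)f_{n+1}^2 + \left(\frac{f_{n-2}}{2}-1\right)f_{n+2}^2 - f_n^2$. (3) If $f_{n+2}$ is even (that is, $n=3k-2$ with $k\geq 2$), then $\mathrm{F}(S(n)) = \left(\frac{f_{n+2}}{2}-1\right)f_{n+1}^2 + \left(\frac{f_{n-2}+f_n}{2}-1\right)f_{n+2}^2 - f_n^2$.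
   Context: The Fibonacci numbers are defined by $f_0=0$, $f_1=1$, $f_k=f_{k-1}+f_{k-2}$ for $k\geq 2$. $\langle a_1,a_2,a_3\rangle$ denotes the set of all non-negative integer linear combinations of $a_1,a_2,a_3$; for $n\geq4$ this is a numerical semigroup (a submonoid of $(\mathbb{N},+)$ with finite complement in $\mathbb{N}$). The Frobenius number $\mathrm{F}(S)$ of a numerical semigroup $S$ is the largest integer not in $S$. -}

module Defs where

open import Data.Nat using (ℕ; zero; suc; _+_; _*_; _<_)
open import Data.Product using (∃-syntax; _×_)
open import Relation.Binary.PropositionalEquality using (_≡_)
open import Relation.Nullary using (¬_)

fib : ℕ → ℕ
fib zero = 0
fib (suc zero) = 1
fib (suc (suc k)) = fib (suc k) + fib k

⟨_,_,_⟩ : ℕ → ℕ → ℕ → ℕ → Set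
⟨ a , b , c ⟩ m = ∃[ x ] ∃[ y ] ∃[ z ] x * a + y * b + z * c ≡ m

IsFrobeniusNumber : (ℕ → Set) → ℕ → Set
IsFrobeniusNumber S F = ¬ S F × (∀ m → F < m → S m)

S : ℕ → ℕ → Set
S n = ⟨ fib n * fib n , fib (n + 1) * fib (n + 1) , fib (n + 2) * fib (n + 2) ⟩

{-# OPTIONS --safe #-}
module Submission where

-- Write A = fₙ², B = fₙ₊₁², C = fₙ₊₂². In each of the three cases the semigroup has explicit
-- relations c₂B = r₂₁A + r₂₃C and c₃C = r₃₁A + r₃₂B with c₂c₃ - r₂₃r₃₂ = A; writing fₘ = 2w and
-- fₘ₊₁ = 1 + t for the even Fibonacci number fₘ (3 ∣ m) below n makes every Fibonacci number
-- involved linear in w and t, so all the facts needed about them are polynomial identities.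
-- For such relations every combination iB + jC reduces modulo A into the box i < c₂, j < c₃
-- minus the corner i ≥ r₁₂, j ≥ r₁₃, whose largest value is (c₂ - 1)B + (r₁₃ - 1)C when
-- r₂₃C ≤ r₃₂B; since B is invertible modulo A (Cassini), every m above that value minus A lies
-- in S. Conversely, a representation of that value minus A would give an integer syzygy
-- sB + tC = kA with k > 0, s < c₂ and t < r₁₃. The syzygies are the integer combinations
-- α(c₂, -r₂₃, r₂₁) + β(-r₃₂, c₃, r₃₁), and r₃₂c₃ ≤ 2A bounds α by 2, which leaves no room for one.

open import Defs
open import Data.Product using (∃; ∃-syntax; ∃₂; _×_; _,_)
open import Data.Sum using (_⊎_; inj₁; inj₂)
open import Data.List using (List; _∷_; [])
open import Relation.Nullary using (¬_; yes; no; contradiction)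
open import Relation.Binary.PropositionalEquality

module IntegerSyzygies where
  open import Data.Nat using (ℕ; suc)
  open import Data.Integer using (ℤ; +_; -[1+_]; 1ℤ; _+_; _-_; _*_; -_; NonZero)
  open import Data.Integer.Properties using (*-cancelʳ-≡; +-identityʳ)
  open import Data.Integer.Tactic.RingSolver using (solve-∀; solve)
  open ≡-Reasoning

  -- Identities that hold modulo hypotheses xᵢ ≡ yᵢ are proved by writing one side as the other
  -- plus Σ fᵢ (xᵢ - yᵢ), which the ring solver checks, and then dropping these terms.
  linear-combination : ∀ {x y e} f → x ≡ y → e + f * (x - y) ≡ e
  linear-combination {x} {e = e} f refl = vanish e f x
    where
    vanish : ∀ e f x → e + f * (x - x) ≡ e
    vanish = solve-∀

  linear-combination₃ : ∀ {x₁ y₁ x₂ y₂ x₃ y₃ e} f₁ f₂ f₃ → x₁ ≡ y₁ → x₂ ≡ y₂ → x₃ ≡ y₃ →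
                        e + f₁ * (x₁ - y₁) + f₂ * (x₂ - y₂) + f₃ * (x₃ - y₃) ≡ e
  linear-combination₃ f₁ f₂ f₃ h₁ h₂ h₃ =
    trans (linear-combination f₃ h₃) (trans (linear-combination f₂ h₂) (linear-combination f₁ h₁))

  difference-rearranged : ∀ P Y a₁ a₂ b₁ b₂ c d {α β} → α ≡ a₁ - a₂ → β ≡ b₁ - b₂ →
                          P - Y ≡ α * c - β * d → a₂ * c + (b₁ * d + P) ≡ a₁ * c + (b₂ * d + Y)
  difference-rearranged P Y a₁ a₂ b₁ b₂ c d refl refl eq = begin
    a₂ * c + (b₁ * d + P)
      ≡⟨ solve (P ∷ Y ∷ a₁ ∷ a₂ ∷ b₁ ∷ b₂ ∷ c ∷ d ∷ []) ⟩
    a₁ * c + (b₂ * d + Y) + 1ℤ * (P - Y - ((a₁ - a₂) * c - (b₁ - b₂) * d))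
      ≡⟨ linear-combination 1ℤ eq ⟩
    a₁ * c + (b₂ * d + Y) ∎

  sum-rearranged : ∀ K a₁ a₂ b₁ b₂ c d {α β} → α ≡ a₁ - a₂ → β ≡ b₁ - b₂ →
                   K ≡ α * c + β * d → K + (a₂ * c + b₂ * d) ≡ a₁ * c + b₁ * d
  sum-rearranged K a₁ a₂ b₁ b₂ c d refl refl eq = begin
    K + (a₂ * c + b₂ * d)
      ≡⟨ solve (K ∷ a₁ ∷ a₂ ∷ b₁ ∷ b₂ ∷ c ∷ d ∷ []) ⟩
    a₁ * c + b₁ * d + 1ℤ * (K - ((a₁ - a₂) * c + (b₁ - b₂) * d))
      ≡⟨ linear-combination 1ℤ eq ⟩
    a₁ * c + b₁ * d ∎

  syzygy-rearranged : ∀ k y z P Q A B C → k * A + y * B + z * C ≡ P * B + Q * C →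
                      (P - y) * B + (Q - z) * C ≡ k * A
  syzygy-rearranged k y z P Q A B C eq = begin
    (P - y) * B + (Q - z) * C
      ≡⟨ solve (k ∷ y ∷ z ∷ P ∷ Q ∷ A ∷ B ∷ C ∷ []) ⟩
    k * A + (- 1ℤ) * (k * A + y * B + z * C - (P * B + Q * C))
      ≡⟨ linear-combination (- 1ℤ) eq ⟩
    k * A ∎

  module Lattice (A B C c₂ c₃ r₂₁ r₂₃ r₃₁ r₃₂ u v : ℤ) .{{_ : NonZero A}}
    (rel₂ : c₂ * B ≡ r₂₁ * A + r₂₃ * C) (rel₃ : c₃ * C ≡ r₃₁ * A + r₃₂ * B)
    (det : c₂ * c₃ ≡ A + r₂₃ * r₃₂) (inv : u * B ≡ v * A + 1ℤ) where

    module _ (s t k : ℤ) (syz : s * B + t * C ≡ k * A) where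

      private
        vars : List ℤ
        vars = A ∷ B ∷ C ∷ c₂ ∷ c₃ ∷ r₂₁ ∷ r₂₃ ∷ r₃₁ ∷ r₃₂ ∷ u ∷ v ∷ s ∷ t ∷ k ∷ []

      -- s c₃ + t r₃₂ ≡ u (s c₃ + t r₃₂) B ≡ u c₃ (s B + t C) ≡ 0 (mod A), using u B ≡ 1 and
      -- r₃₂ B ≡ c₃ C; the second coordinate is divisible for the same reason.
      first-coordinate : ∃ λ α → α * A ≡ s * c₃ + t * r₃₂
      first-coordinate = u * (c₃ * k - t * r₃₁) - v * (s * c₃ + t * r₃₂) , (begin
        (u * (c₃ * k - t * r₃₁) - v * (s * c₃ + t * r₃₂)) * A
          ≡⟨ solve vars ⟩
        s * c₃ + t * r₃₂ + (s * c₃ + t * r₃₂) * (u * B - (v * A + 1ℤ))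
          + u * c₃ * (k * A - (s * B + t * C)) + u * t * (c₃ * C - (r₃₁ * A + r₃₂ * B))
          ≡⟨ linear-combination₃ (s * c₃ + t * r₃₂) (u * c₃) (u * t) inv (sym syz) rel₃ ⟩
        s * c₃ + t * r₃₂ ∎)

      second-coordinate : ∃ λ β → β * A ≡ t * c₂ + s * r₂₃
      second-coordinate = u * (t * r₂₁ + r₂₃ * k) - v * (t * c₂ + s * r₂₃) , (begin
        (u * (t * r₂₁ + r₂₃ * k) - v * (t * c₂ + s * r₂₃)) * A
          ≡⟨ solve vars ⟩
        t * c₂ + s * r₂₃ + (t * c₂ + s * r₂₃) * (u * B - (v * A + 1ℤ))
          + u * r₂₃ * (k * A - (s * B + t * C)) + u * t * (r₂₁ * A + r₂₃ * C - c₂ * B)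
          ≡⟨ linear-combination₃ (t * c₂ + s * r₂₃) (u * r₂₃) (u * t) inv (sym syz) (sym rel₂) ⟩
        t * c₂ + s * r₂₃ ∎)

    syzygy-decomposition : ∀ s t k → s * B + t * C ≡ k * A →
      ∃₂ λ α β → s ≡ α * c₂ - β * r₃₂ × t ≡ β * c₃ - α * r₂₃ × k ≡ α * r₂₁ + β * r₃₁
    syzygy-decomposition s t k syz with first-coordinate s t k syz | second-coordinate s t k syz
    ... | α , αA | β , βA = α , β , s≡ , t≡ , k≡
      where
      vars : List ℤ
      vars = A ∷ B ∷ C ∷ c₂ ∷ c₃ ∷ r₂₁ ∷ r₂₃ ∷ r₃₁ ∷ r₃₂ ∷ s ∷ t ∷ k ∷ α ∷ β ∷ []

      s≡ : s ≡ α * c₂ - β * r₃₂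
      s≡ = *-cancelʳ-≡ _ _ A (begin
        s * A
          ≡⟨ solve vars ⟩
        (α * c₂ - β * r₃₂) * A + (- c₂) * (α * A - (s * c₃ + t * r₃₂))
          + r₃₂ * (β * A - (t * c₂ + s * r₂₃)) + (- s) * (c₂ * c₃ - (A + r₂₃ * r₃₂))
          ≡⟨ linear-combination₃ (- c₂) r₃₂ (- s) αA βA det ⟩
        (α * c₂ - β * r₃₂) * A ∎)

      t≡ : t ≡ β * c₃ - α * r₂₃
      t≡ = *-cancelʳ-≡ _ _ A (begin
        t * A
          ≡⟨ solve vars ⟩
        (β * c₃ - α * r₂₃) * A + (- c₃) * (β * A - (t * c₂ + s * r₂₃))
          + r₂₃ * (α * A - (s * c₃ + t * r₃₂)) + (- t) * (c₂ * c₃ - (A + r₂₃ * r₃₂))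
          ≡⟨ linear-combination₃ (- c₃) r₂₃ (- t) βA αA det ⟩
        (β * c₃ - α * r₂₃) * A ∎)

      k≡ : k ≡ α * r₂₁ + β * r₃₁
      k≡ = *-cancelʳ-≡ _ _ A (begin
        k * A
          ≡⟨ solve vars ⟩
        (α * r₂₁ + β * r₃₁) * A + α * (c₂ * B - (r₂₁ * A + r₂₃ * C)) + β * (c₃ * C - (r₃₁ * A + r₃₂ * B))
          + (- 1ℤ) * (s * B + t * C - k * A) + B * (s - (α * c₂ - β * r₃₂)) + C * (t - (β * c₃ - α * r₂₃))
          ≡⟨ linear-combination₃ (- 1ℤ) B C syz s≡ t≡ ⟩
        (α * r₂₁ + β * r₃₁) * A + α * (c₂ * B - (r₂₁ * A + r₂₃ * C)) + β * (c₃ * C - (r₃₁ * A + r₃₂ * B))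
          ≡⟨ linear-combination β rel₃ ⟩
        (α * r₂₁ + β * r₃₁) * A + α * (c₂ * B - (r₂₁ * A + r₂₃ * C))
          ≡⟨ linear-combination α rel₂ ⟩
        (α * r₂₁ + β * r₃₁) * A ∎)

  data Signed : ℕ → ℕ → Set where
    nonneg : ∀ a → Signed a 0
    neg    : ∀ a → Signed 0 (suc a)

  signed : ∀ α → ∃₂ λ a₁ a₂ → Signed a₁ a₂ × α ≡ + a₁ - + a₂
  signed (+ a)    = a , 0 , nonneg a , sym (+-identityʳ (+ a))
  signed -[1+ a ] = 0 , suc a , neg a , refl

module ThreeGenerated where
  open import Data.Nat
  open import Data.Nat.Properties
  open import Data.Nat.Tactic.RingSolver using (solve)
  open import Data.Empty using (⊥)
  open import Relation.Binary.Definitions using (tri<; tri≈; tri>)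
  open import Data.Integer as ℤ using (+_)
  import Data.Integer.Properties as ℤ
  open IntegerSyzygies

  -- Herzog's description of ⟨ A , B , C ⟩: c₁ A = r₁₂ B + r₁₃ C, c₂ B = r₂₁ A + r₂₃ C and
  -- c₃ C = r₃₁ A + r₃₂ B with c₁ = r₂₁ + r₃₁, c₂ = r₁₂ + r₃₂ = 1 + p, r₁₃ = 1 + q, c₃ = r₁₃ + r₂₃.
  record MinimalRelations (A B C p q r₁₂ r₂₁ r₂₃ r₃₁ r₃₂ : ℕ) : Set where
    field
      c₂-split    : r₁₂ + r₃₂ ≡ suc p
      relation₂   : suc p * B ≡ r₂₁ * A + r₂₃ * C
      relation₃   : (suc q + r₂₃) * C ≡ r₃₁ * A + r₃₂ * B
      determinant : suc p * (suc q + r₂₃) ≡ A + r₂₃ * r₃₂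
      A>0         : 0 < A
      r₂₁>0       : 0 < r₂₁
      r₃₁>0       : 0 < r₃₁
      r₃₂c₃≤2A    : r₃₂ * (suc q + r₂₃) ≤ 2 * A
      r₂₃C≤r₃₂B   : r₂₃ * C ≤ r₃₂ * B

  <⇒≢+ : ∀ {n m} s → n < m → n ≢ m + s
  <⇒≢+ {m = m} s n<m n≡m+s = m+n≮m m s (subst (_< m) n≡m+s n<m)

  quotient-bound : ∀ A n k m W → n * A + m ≡ k * A + W → W < m + A → n ≤ k
  quotient-bound A n k m W eq W<m+A with n ≤? k
  ... | yes n≤k = n≤k
  ... | no n≰k = contradiction (sym eq) (<⇒≢ (begin-strict
    k * A + W         <⟨ +-monoʳ-< (k * A) W<m+A ⟩
    k * A + (m + A)   ≡⟨ solve (A ∷ k ∷ m ∷ []) ⟩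
    suc k * A + m     ≤⟨ +-monoˡ-≤ m (*-monoˡ-≤ A (≰⇒> n≰k)) ⟩
    n * A + m ∎))
    where open ≤-Reasoning

  pos-*+* : ∀ a x b y → + (a * x + b * y) ≡ + a ℤ.* + x ℤ.+ + b ℤ.* + y
  pos-*+* a x b y = cong₂ ℤ._+_ (ℤ.pos-* a x) (ℤ.pos-* b y)

  pos-*+*+ : ∀ a x b y n → + (a * x + (b * y + n)) ≡ + a ℤ.* + x ℤ.+ (+ b ℤ.* + y ℤ.+ + n)
  pos-*+*+ a x b y n = cong₂ ℤ._+_ (ℤ.pos-* a x) (cong (λ z → z ℤ.+ + n) (ℤ.pos-* b y))

  module _ {A B C p q r₁₂ r₂₁ r₂₃ r₃₁ r₃₂ : ℕ} (R : MinimalRelations A B C p q r₁₂ r₂₁ r₂₃ r₃₁ r₃₂) where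
    open MinimalRelations R

    Region : ℕ → ℕ → Set
    Region i j = i ≤ p × j < suc q + r₂₃ × (i < r₁₂ ⊎ j ≤ q)

    Reducible : ℕ → ℕ → Set
    Reducible i j = ∃[ k ] ∃[ i′ ] ∃[ j′ ] 0 < k × i * B + j * C ≡ k * A + (i′ * B + j′ * C)

    reduce-B : ∀ i j → Reducible (suc p + i) j
    reduce-B i j = r₂₁ , i , r₂₃ + j , r₂₁>0 , (begin
      (suc p + i) * B + j * C       ≡⟨ solve (p ∷ i ∷ j ∷ B ∷ C ∷ []) ⟩
      suc p * B + (i * B + j * C)   ≡⟨ cong (_+ (i * B + j * C)) relation₂ ⟩
      r₂₁ * A + r₂₃ * C + (i * B + j * C)
        ≡⟨ solve (A ∷ B ∷ C ∷ r₂₁ ∷ r₂₃ ∷ i ∷ j ∷ []) ⟩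
      r₂₁ * A + (i * B + (r₂₃ + j) * C) ∎)
      where open ≡-Reasoning

    reduce-C : ∀ i j → Reducible i (suc q + r₂₃ + j)
    reduce-C i j = r₃₁ , r₃₂ + i , j , r₃₁>0 , (begin
      i * B + (suc q + r₂₃ + j) * C          ≡⟨ solve (q ∷ r₂₃ ∷ i ∷ j ∷ B ∷ C ∷ []) ⟩
      (suc q + r₂₃) * C + (i * B + j * C)    ≡⟨ cong (_+ (i * B + j * C)) relation₃ ⟩
      r₃₁ * A + r₃₂ * B + (i * B + j * C)
        ≡⟨ solve (A ∷ B ∷ C ∷ r₃₁ ∷ r₃₂ ∷ i ∷ j ∷ []) ⟩
      r₃₁ * A + ((r₃₂ + i) * B + j * C) ∎)
      where open ≡-Reasoning

    reduce-corner : ∀ i j → Reducible (r₁₂ + i) (suc q + j)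
    reduce-corner i j = r₂₁ + r₃₁ , i , j , <-≤-trans r₂₁>0 (m≤m+n r₂₁ r₃₁) ,
      +-cancelʳ-≡ (r₃₂ * B + r₂₃ * C) _ _ (begin
      (r₁₂ + i) * B + (suc q + j) * C + (r₃₂ * B + r₂₃ * C)
        ≡⟨ solve (B ∷ C ∷ q ∷ r₁₂ ∷ r₂₃ ∷ r₃₂ ∷ i ∷ j ∷ []) ⟩
      (r₁₂ + r₃₂) * B + (suc q + r₂₃) * C + (i * B + j * C)
        ≡⟨ cong₂ (λ c₂ c₃C → c₂ * B + c₃C + (i * B + j * C)) c₂-split relation₃ ⟩
      suc p * B + (r₃₁ * A + r₃₂ * B) + (i * B + j * C)
        ≡⟨ cong (λ c₂B → c₂B + (r₃₁ * A + r₃₂ * B) + (i * B + j * C)) relation₂ ⟩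
      r₂₁ * A + r₂₃ * C + (r₃₁ * A + r₃₂ * B) + (i * B + j * C)
        ≡⟨ solve (A ∷ B ∷ C ∷ r₂₁ ∷ r₂₃ ∷ r₃₁ ∷ r₃₂ ∷ i ∷ j ∷ []) ⟩
      (r₂₁ + r₃₁) * A + (i * B + j * C) + (r₃₂ * B + r₂₃ * C) ∎)
      where open ≡-Reasoning

    step : ∀ i j → Region i j ⊎ Reducible i j
    step i j with suc p ≤? i | suc q + r₂₃ ≤? j | r₁₂ ≤? i | suc q ≤? j
    ... | yes c₂≤i | _ | _ | _ with m≤n⇒∃[o]m+o≡n c₂≤i
    ...   | i₀ , refl = inj₂ (reduce-B i₀ j)
    step i j | no i≱c₂ | yes c₃≤j | _ | _ with m≤n⇒∃[o]m+o≡n c₃≤j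
    ...   | j₀ , refl = inj₂ (reduce-C i j₀)
    step i j | no i≱c₂ | no j≱c₃ | yes r₁₂≤i | yes r₁₃≤j with m≤n⇒∃[o]m+o≡n r₁₂≤i | m≤n⇒∃[o]m+o≡n r₁₃≤j
    ...   | i₀ , refl | j₀ , refl = inj₂ (reduce-corner i₀ j₀)
    step i j | no i≱c₂ | no j≱c₃ | no i≱r₁₂ | _ =
      inj₁ (≤-pred (≰⇒> i≱c₂) , ≰⇒> j≱c₃ , inj₁ (≰⇒> i≱r₁₂))
    step i j | no i≱c₂ | no j≱c₃ | yes _ | no j≱r₁₃ =
      inj₁ (≤-pred (≰⇒> i≱c₂) , ≰⇒> j≱c₃ , inj₂ (≤-pred (≰⇒> j≱r₁₃)))

    to-region : ∀ N i j → i * B + j * C < N →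
      ∃[ k ] ∃[ i′ ] ∃[ j′ ] i * B + j * C ≡ k * A + (i′ * B + j′ * C) × Region i′ j′
    to-region (suc N) i j iB+jC≤N with step i j
    ... | inj₁ region = 0 , i , j , refl , region
    ... | inj₂ (k , i′ , j′ , k>0 , eq) with to-region N i′ j′ smaller
      where
      smaller : i′ * B + j′ * C < N
      smaller = <-≤-trans (subst (i′ * B + j′ * C <_) (sym eq) (m<n+m _ (*-mono-< k>0 A>0)))
                          (≤-pred iB+jC≤N)
    ...   | k′ , i″ , j″ , eq′ , region = k + k′ , i″ , j″ , (begin
      i * B + j * C                   ≡⟨ eq ⟩
      k * A + (i′ * B + j′ * C)       ≡⟨ cong (λ X → k * A + X) eq′ ⟩
      k * A + (k′ * A + (i″ * B + j″ * C))
        ≡⟨ solve (A ∷ B ∷ C ∷ k ∷ k′ ∷ i″ ∷ j″ ∷ []) ⟩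
      (k + k′) * A + (i″ * B + j″ * C) ∎) , region
      where open ≡-Reasoning

    region-bound : ∀ {i j} → Region i j → i * B + j * C ≤ p * B + q * C
    region-bound (i≤p , _ , inj₂ j≤q) = +-mono-≤ (*-monoˡ-≤ B i≤p) (*-monoˡ-≤ C j≤q)
    region-bound {i} {j} (_ , j<c₃ , inj₁ i<r₁₂) = begin
      i * B + j * C                 ≤⟨ +-monoʳ-≤ (i * B) (*-monoˡ-≤ C (≤-pred j<c₃)) ⟩
      i * B + (q + r₂₃) * C         ≡⟨ solve (B ∷ C ∷ q ∷ r₂₃ ∷ i ∷ []) ⟩
      i * B + q * C + r₂₃ * C       ≤⟨ +-monoʳ-≤ (i * B + q * C) r₂₃C≤r₃₂B ⟩
      i * B + q * C + r₃₂ * B       ≡⟨ solve (B ∷ C ∷ q ∷ r₃₂ ∷ i ∷ []) ⟩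
      (i + r₃₂) * B + q * C         ≤⟨ +-monoˡ-≤ (q * C) (*-monoˡ-≤ B i+r₃₂≤p) ⟩
      p * B + q * C ∎
      where
      open ≤-Reasoning
      i+r₃₂≤p : i + r₃₂ ≤ p
      i+r₃₂≤p = ≤-pred (subst (suc i + r₃₂ ≤_) c₂-split (+-monoˡ-≤ r₃₂ i<r₁₂))

    r₃₂≤c₂ : r₃₂ ≤ suc p
    r₃₂≤c₂ = subst (r₃₂ ≤_) c₂-split (m≤n+m r₃₂ r₁₂)

    q<[1+b]*c₃ : ∀ b → q < suc b * (suc q + r₂₃)
    q<[1+b]*c₃ b = ≤-trans (m≤m+n (suc q) r₂₃) (m≤m+n (suc q + r₂₃) (b * (suc q + r₂₃)))

    -- c₃ times the first plus r₃₂ times the second equation, simplified by the determinant,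
    -- gives αA + (c₃ + …) = A + r₃₂c₃ ≤ 3A.
    coefficient<3 : ∀ α b y z → b * r₃₂ + p ≡ α * suc p + y → α * r₂₃ + q ≡ b * (suc q + r₂₃) + z →
                    α < 3
    coefficient<3 α b y z e₁ e₂ = *-cancelʳ-< A α 3 (begin-strict
      α * A
        <⟨ m<m+n (α * A) z<s ⟩
      α * A + (suc q + r₂₃ + ((suc q + r₂₃) * y + r₃₂ * z + r₃₂))
        ≡⟨ +-cancelʳ-≡ (r₃₂ * (b * (suc q + r₂₃)) + α * (r₂₃ * r₃₂)) _ _ identity ⟩
      A + r₃₂ * (suc q + r₂₃)
        ≤⟨ +-monoʳ-≤ A r₃₂c₃≤2A ⟩
      3 * A ∎)
      where
      open ≤-Reasoning
      identity : α * A + (suc q + r₂₃ + ((suc q + r₂₃) * y + r₃₂ * z + r₃₂))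
                   + (r₃₂ * (b * (suc q + r₂₃)) + α * (r₂₃ * r₃₂))
               ≡ A + r₃₂ * (suc q + r₂₃) + (r₃₂ * (b * (suc q + r₂₃)) + α * (r₂₃ * r₃₂))
      identity = ≡.begin
        α * A + (suc q + r₂₃ + ((suc q + r₂₃) * y + r₃₂ * z + r₃₂))
          + (r₃₂ * (b * (suc q + r₂₃)) + α * (r₂₃ * r₃₂))
          ≡.≡⟨ solve vars ⟩
        α * (A + r₂₃ * r₃₂) + (suc q + r₂₃) * y + r₃₂ * (b * (suc q + r₂₃) + z) + (suc q + r₂₃) + r₃₂
          ≡.≡⟨ cong₂ (λ c₂c₃ r₂₃+q → α * c₂c₃ + (suc q + r₂₃) * y + r₃₂ * r₂₃+q + (suc q + r₂₃) + r₃₂)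
                     (sym determinant) (sym e₂) ⟩
        α * (suc p * (suc q + r₂₃)) + (suc q + r₂₃) * y + r₃₂ * (α * r₂₃ + q) + (suc q + r₂₃) + r₃₂
          ≡.≡⟨ solve vars ⟩
        (suc q + r₂₃) * (α * suc p + y) + r₃₂ * (α * r₂₃ + q) + (suc q + r₂₃) + r₃₂
          ≡.≡⟨ cong (λ c₂ → (suc q + r₂₃) * c₂ + r₃₂ * (α * r₂₃ + q) + (suc q + r₂₃) + r₃₂) (sym e₁) ⟩
        (suc q + r₂₃) * (b * r₃₂ + p) + r₃₂ * (α * r₂₃ + q) + (suc q + r₂₃) + r₃₂
          ≡.≡⟨ solve vars ⟩
        suc p * (suc q + r₂₃) + r₃₂ * suc q + (r₃₂ * (b * (suc q + r₂₃)) + α * (r₂₃ * r₃₂))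
          ≡.≡⟨ cong (λ c₂c₃ → c₂c₃ + r₃₂ * suc q + (r₃₂ * (b * (suc q + r₂₃)) + α * (r₂₃ * r₃₂)))
                    determinant ⟩
        A + r₂₃ * r₃₂ + r₃₂ * suc q + (r₃₂ * (b * (suc q + r₂₃)) + α * (r₂₃ * r₃₂))
          ≡.≡⟨ solve vars ⟩
        A + r₃₂ * (suc q + r₂₃) + (r₃₂ * (b * (suc q + r₂₃)) + α * (r₂₃ * r₃₂)) ≡.∎
        where
        module ≡ = ≡-Reasoning
        vars : List ℕ
        vars = A ∷ p ∷ q ∷ r₂₃ ∷ r₃₂ ∷ α ∷ b ∷ y ∷ z ∷ []

    no-positive-point : ∀ a b y z → b * r₃₂ + p ≡ suc a * suc p + y →
                        suc a * r₂₃ + q ≡ b * (suc q + r₂₃) + z → ⊥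
    no-positive-point a zero y _ e₁ _ = <⇒≢+ y (m≤m+n (suc p) (a * suc p)) e₁
    no-positive-point zero (suc b) _ z _ e₂ = <⇒≢+ z (begin-strict
      1 * r₂₃ + q                   ≡⟨ solve (q ∷ r₂₃ ∷ []) ⟩
      q + r₂₃                       <⟨ n<1+n (q + r₂₃) ⟩
      suc q + r₂₃                   ≤⟨ m≤m+n (suc q + r₂₃) (b * (suc q + r₂₃)) ⟩
      suc b * (suc q + r₂₃) ∎) e₂
      where open ≤-Reasoning
    no-positive-point 1 1 y _ e₁ _ = <⇒≢+ y (begin-strict
      1 * r₃₂ + p     ≡⟨ solve (r₃₂ ∷ p ∷ []) ⟩
      r₃₂ + p         ≤⟨ +-monoˡ-≤ p r₃₂≤c₂ ⟩
      suc p + p       <⟨ +-monoʳ-< (suc p) (n<1+n p) ⟩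
      suc p + suc p   ≡⟨ solve (p ∷ []) ⟩
      2 * suc p ∎) e₁
      where open ≤-Reasoning
    no-positive-point 1 (suc (suc b)) _ z _ e₂ = <⇒≢+ z (begin-strict
      2 * r₂₃ + q                    <⟨ m≤m+n (suc (2 * r₂₃ + q)) (suc q) ⟩
      suc (2 * r₂₃ + q) + suc q      ≡⟨ solve (q ∷ r₂₃ ∷ []) ⟩
      2 * (suc q + r₂₃)              ≤⟨ *-monoˡ-≤ (suc q + r₂₃) (s≤s (s≤s (z≤n {b}))) ⟩
      suc (suc b) * (suc q + r₂₃) ∎) e₂
      where open ≤-Reasoning
    no-positive-point (suc (suc a)) (suc b) y z e₁ e₂ =
      <⇒≱ (coefficient<3 (3 + a) (suc b) y z e₁ e₂) (s≤s (s≤s (s≤s z≤n)))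

    no-lattice-point : ∀ x y z {a₁ a₂ b₁ b₂} → Signed a₁ a₂ → Signed b₁ b₂ →
      a₂ * suc p + (b₁ * r₃₂ + p) ≡ a₁ * suc p + (b₂ * r₃₂ + y) →
      b₂ * (suc q + r₂₃) + (a₁ * r₂₃ + q) ≡ b₁ * (suc q + r₂₃) + (a₂ * r₂₃ + z) →
      suc x + (a₂ * r₂₁ + b₂ * r₃₁) ≡ a₁ * r₂₁ + b₁ * r₃₁ → ⊥
    no-lattice-point _ _ _ (nonneg zero)    (nonneg zero)    _  _  ()
    no-lattice-point _ _ z (nonneg zero)    (nonneg (suc b)) _  e₂ _ = <⇒≢+ z (q<[1+b]*c₃ b) e₂
    no-lattice-point _ y z (nonneg (suc a)) (nonneg b)       e₁ e₂ _ = no-positive-point a b y z e₁ e₂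
    no-lattice-point _ _ _ (nonneg zero)    (neg b)          _  _  ()
    no-lattice-point _ y _ (nonneg (suc a)) (neg b)          e₁ _  _ =
      <⇒≢+ (suc b * r₃₂ + y) (m≤m+n (suc p) (a * suc p)) e₁
    no-lattice-point _ _ _ (neg a)          (nonneg zero)    _  _  ()
    no-lattice-point _ _ z (neg a)          (nonneg (suc b)) _  e₂ _ =
      <⇒≢+ (suc a * r₂₃ + z) (q<[1+b]*c₃ b) e₂
    no-lattice-point _ _ _ (neg a)          (neg b)          _  _  ()

    module _ {u v : ℕ} (B-invertible : u * B ≡ v * A + 1) where

      multiple-of-B : ∀ m → m * u * B + 0 * C ≡ m * v * A + m
      multiple-of-B m = begin
        m * u * B + 0 * C   ≡⟨ solve (B ∷ C ∷ m ∷ u ∷ []) ⟩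
        m * (u * B)         ≡⟨ cong (m *_) B-invertible ⟩
        m * (v * A + 1)     ≡⟨ solve (A ∷ m ∷ v ∷ []) ⟩
        m * v * A + m ∎
        where open ≡-Reasoning

      open Lattice (+ A) (+ B) (+ C) (+ suc p) (+ (suc q + r₂₃)) (+ r₂₁) (+ r₂₃) (+ r₃₁) (+ r₃₂) (+ u) (+ v)
        {{>-nonZero A>0}}
        (trans (sym (ℤ.pos-* (suc p) B)) (trans (cong +_ relation₂) (pos-*+* r₂₁ A r₂₃ C)))
        (trans (sym (ℤ.pos-* (suc q + r₂₃) C)) (trans (cong +_ relation₃) (pos-*+* r₃₁ A r₃₂ B)))
        (trans (sym (ℤ.pos-* (suc p) (suc q + r₂₃)))
               (trans (cong +_ determinant) (cong (ℤ._+_ (+ A)) (ℤ.pos-* r₂₃ r₃₂))))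
        (trans (sym (ℤ.pos-* u B)) (trans (cong +_ B-invertible) (cong (λ z → z ℤ.+ + 1) (ℤ.pos-* v A))))

      integer-syzygy : ∀ k y z → k * A + y * B + z * C ≡ p * B + q * C →
        (+ p ℤ.- + y) ℤ.* + B ℤ.+ (+ q ℤ.- + z) ℤ.* + C ≡ + k ℤ.* + A
      integer-syzygy k y z syz = syzygy-rearranged (+ k) (+ y) (+ z) (+ p) (+ q) (+ A) (+ B) (+ C)
        (trans (sym (cong₂ ℤ._+_ (pos-*+* k A y B) (ℤ.pos-* z C))) (trans (cong +_ syz) (pos-*+* p B q C)))

      -- In terms of α = a₁ - a₂ and β = b₁ - b₂ the conclusion says
      -- (p - y, q - z, k) = α (c₂, -r₂₃, r₂₁) + β (-r₃₂, c₃, r₃₁).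
      syzygy-coordinates : ∀ k y z → k * A + y * B + z * C ≡ p * B + q * C →
        ∃₂ λ a₁ a₂ → ∃₂ λ b₁ b₂ → Signed a₁ a₂ × Signed b₁ b₂ ×
          a₂ * suc p + (b₁ * r₃₂ + p) ≡ a₁ * suc p + (b₂ * r₃₂ + y) ×
          b₂ * (suc q + r₂₃) + (a₁ * r₂₃ + q) ≡ b₁ * (suc q + r₂₃) + (a₂ * r₂₃ + z) ×
          k + (a₂ * r₂₁ + b₂ * r₃₁) ≡ a₁ * r₂₁ + b₁ * r₃₁
      syzygy-coordinates k y z syz =
        let α , β , s≡ , t≡ , k≡ =
              syzygy-decomposition (+ p ℤ.- + y) (+ q ℤ.- + z) (+ k) (integer-syzygy k y z syz)
            a₁ , a₂ , σ , α≡ = signed α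
            b₁ , b₂ , τ , β≡ = signed β
        in a₁ , a₂ , b₁ , b₂ , σ , τ ,
           ℤ.+-injective (trans (pos-*+*+ a₂ (suc p) b₁ r₃₂ p) (trans
             (difference-rearranged (+ p) (+ y) (+ a₁) (+ a₂) (+ b₁) (+ b₂) (+ suc p) (+ r₃₂) α≡ β≡ s≡)
             (sym (pos-*+*+ a₁ (suc p) b₂ r₃₂ y)))) ,
           ℤ.+-injective (trans (pos-*+*+ b₂ (suc q + r₂₃) a₁ r₂₃ q) (trans
             (difference-rearranged (+ q) (+ z) (+ b₁) (+ b₂) (+ a₁) (+ a₂) (+ (suc q + r₂₃)) (+ r₂₃)
                                    β≡ α≡ t≡)
             (sym (pos-*+*+ b₁ (suc q + r₂₃) a₂ r₂₃ z)))) ,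
           ℤ.+-injective (trans (cong (ℤ._+_ (+ k)) (pos-*+* a₂ r₂₁ b₂ r₃₁)) (trans
             (sum-rearranged (+ k) (+ a₁) (+ a₂) (+ b₁) (+ b₂) (+ r₂₁) (+ r₃₁) α≡ β≡ k≡)
             (sym (pos-*+* a₁ r₂₁ b₁ r₃₁))))

      -- m ≡ m u B (mod A), and reducing (m u, 0) into the region writes m as k′A + iB + jC.
      ∈-above : ∀ {m} → p * B + q * C < m + A → ⟨ A , B , C ⟩ m
      ∈-above {m} above with to-region (suc (m * u * B + 0 * C)) (m * u) 0 ≤-refl
      ... | k , i , j , eq , region
        with m≤n⇒∃[o]m+o≡n (quotient-bound A (m * v) k m (i * B + j * C)
               (trans (sym (multiple-of-B m)) eq) (≤-<-trans (region-bound region) above))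
      ...   | k′ , refl = k′ , i , j , +-cancelˡ-≡ (m * v * A) _ _ (begin
        m * v * A + (k′ * A + i * B + j * C)   ≡⟨ solve (A ∷ B ∷ C ∷ m ∷ v ∷ k′ ∷ i ∷ j ∷ []) ⟩
        (m * v + k′) * A + (i * B + j * C)     ≡⟨ sym eq ⟩
        m * u * B + 0 * C                      ≡⟨ multiple-of-B m ⟩
        m * v * A + m ∎)
        where open ≡-Reasoning

      ∉-candidate : ∀ {m} → m + A ≡ p * B + q * C → ¬ ⟨ A , B , C ⟩ m
      ∉-candidate {m} m+A≡ (x , y , z , eq) =
        let a₁ , a₂ , b₁ , b₂ , σ , τ , e₁ , e₂ , e₃ = syzygy-coordinates (suc x) y z shifted
        in no-lattice-point x y z σ τ e₁ e₂ e₃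
        where
        shifted : suc x * A + y * B + z * C ≡ p * B + q * C
        shifted = begin
          suc x * A + y * B + z * C   ≡⟨ solve (A ∷ B ∷ C ∷ x ∷ y ∷ z ∷ []) ⟩
          x * A + y * B + z * C + A   ≡⟨ cong (_+ A) eq ⟩
          m + A                       ≡⟨ m+A≡ ⟩
          p * B + q * C ∎
          where open ≡-Reasoning

      frobenius-number : ∀ {F} → IsFrobeniusNumber ⟨ A , B , C ⟩ F → F + A ≡ p * B + q * C
      frobenius-number {F} (F∉S , above-F∈S) with <-cmp (F + A) (p * B + q * C)
      ... | tri≈ _ F+A≡ _ = F+A≡
      ... | tri> _ _ F+A> = contradiction (∈-above F+A>) F∉S
      ... | tri< F+A< _ _ with m≤n⇒∃[o]m+o≡n F+A<
      ...   | d , eq = contradiction (above-F∈S (suc (F + d)) (s≤s (m≤m+n F d)))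
                                   (∉-candidate {suc (F + d)} G+A≡)
        where
        open ≡-Reasoning
        G+A≡ : suc (F + d) + A ≡ p * B + q * C
        G+A≡ = begin
          suc (F + d) + A   ≡⟨ solve (F ∷ d ∷ A ∷ []) ⟩
          suc (F + A) + d   ≡⟨ eq ⟩
          p * B + q * C ∎

module Fibonacci where
  open import Data.Nat
  open import Data.Nat.Properties
  open import Data.Nat.Divisibility using (_∣_; ∣m+n∣m⇒∣n; n∣m*n)
  open import Data.Nat.Tactic.RingSolver using (solve-∀; solve)
  open ≡-Reasoning

  fib-+ : ∀ k m → fib (suc k + m) ≡ fib (suc k) * fib (suc m) + fib k * fib m
  fib-+ zero          m = identity (fib (suc m)) (fib m)
    where
    identity : ∀ y x → y ≡ 1 * y + 0 * x
    identity = solve-∀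
  fib-+ (suc zero)    m = identity (fib (suc m)) (fib m)
    where
    identity : ∀ y x → y + x ≡ 1 * y + 1 * x
    identity = solve-∀
  fib-+ (suc (suc k)) m =
    trans (cong₂ _+_ (fib-+ (suc k) m) (fib-+ k m))
          (identity (fib (suc (suc k))) (fib (suc k)) (fib k) (fib (suc m)) (fib m))
    where
    identity : ∀ f₂ f₁ f₀ y x → f₂ * y + f₁ * x + (f₁ * y + f₀ * x) ≡ (f₂ + f₁) * y + (f₁ + f₀) * x
    identity = solve-∀

  fib-suc≡suc : ∀ m → ∃[ t ] fib (suc m) ≡ suc t
  fib-suc≡suc zero    = 0 , refl
  fib-suc≡suc (suc m) with fib-suc≡suc m
  ... | t , eq = t + fib m , cong (_+ fib m) eq

  cassini : ∀ k → fib k * fib (2 + k) ≡ fib (1 + k) * fib (1 + k) + 1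
                ⊎ fib k * fib (2 + k) + 1 ≡ fib (1 + k) * fib (1 + k)
  cassini zero = inj₂ refl
  cassini (suc k) with cassini k
  ... | inj₁ eq = inj₂ (increase (fib k) (fib (suc k)) eq)
    where
    increase : ∀ f₀ f₁ → f₀ * (f₁ + f₀) ≡ f₁ * f₁ + 1 → f₁ * (f₁ + f₀ + f₁) + 1 ≡ (f₁ + f₀) * (f₁ + f₀)
    increase f₀ f₁ eq = begin
      f₁ * (f₁ + f₀ + f₁) + 1           ≡⟨ solve (f₀ ∷ f₁ ∷ []) ⟩
      f₁ * (f₁ + f₀) + (f₁ * f₁ + 1)     ≡⟨ cong (f₁ * (f₁ + f₀) +_) (sym eq) ⟩
      f₁ * (f₁ + f₀) + f₀ * (f₁ + f₀)    ≡⟨ solve (f₀ ∷ f₁ ∷ []) ⟩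
      (f₁ + f₀) * (f₁ + f₀) ∎
  ... | inj₂ eq = inj₁ (decrease (fib k) (fib (suc k)) eq)
    where
    decrease : ∀ f₀ f₁ → f₀ * (f₁ + f₀) + 1 ≡ f₁ * f₁ → f₁ * (f₁ + f₀ + f₁) ≡ (f₁ + f₀) * (f₁ + f₀) + 1
    decrease f₀ f₁ eq = begin
      f₁ * (f₁ + f₀ + f₁)                 ≡⟨ solve (f₀ ∷ f₁ ∷ []) ⟩
      f₁ * (f₁ + f₀) + f₁ * f₁            ≡⟨ cong (f₁ * (f₁ + f₀) +_) (sym eq) ⟩
      f₁ * (f₁ + f₀) + (f₀ * (f₁ + f₀) + 1) ≡⟨ solve (f₀ ∷ f₁ ∷ []) ⟩
      (f₁ + f₀) * (f₁ + f₀) + 1 ∎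

  -- u = e², by squaring e b ≡ ±1 (mod a²).
  squared-inverse : ∀ {a b e} → 0 < e * b → e * b ≡ a * a + 1 ⊎ e * b + 1 ≡ a * a →
                    ∃₂ λ u v → u * (b * b) ≡ v * (a * a) + 1
  squared-inverse {a} {b} {e} _ (inj₁ eq) = e * e , a * a + 2 , (begin
    e * e * (b * b)              ≡⟨ solve (e ∷ b ∷ []) ⟩
    (e * b) * (e * b)            ≡⟨ cong₂ _*_ eq eq ⟩
    (a * a + 1) * (a * a + 1)    ≡⟨ solve (a ∷ []) ⟩
    (a * a + 2) * (a * a) + 1 ∎)
  squared-inverse {a} {b} {e} eb>0 (inj₂ eq) with m≤n⇒∃[o]m+o≡n eb>0
  ... | M , 1+M≡eb = e * e , M , (begin
    e * e * (b * b)              ≡⟨ solve (e ∷ b ∷ []) ⟩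
    (e * b) * (e * b)            ≡⟨ cong₂ _*_ (sym 1+M≡eb) (sym 1+M≡eb) ⟩
    suc M * suc M                ≡⟨ solve (M ∷ []) ⟩
    M * (suc M + 1) + 1          ≡⟨ cong (λ eb → M * (eb + 1) + 1) 1+M≡eb ⟩
    M * (e * b + 1) + 1          ≡⟨ cong (λ a² → M * a² + 1) eq ⟩
    M * (a * a) + 1 ∎)

  fib-square-inverse : ∀ n → ∃₂ λ u v → u * (fib (n + 1) * fib (n + 1)) ≡ v * (fib n * fib n) + 1
  fib-square-inverse zero          = 1 , 0 , refl
  fib-square-inverse (suc zero)    = 1 , 0 , refl
  fib-square-inverse (suc (suc k)) =
    subst (λ b → ∃₂ λ u v → u * (b * b) ≡ v * (fib (2 + k) * fib (2 + k)) + 1) (cong fib (+-comm 1 (2 + k)))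
      (squared-inverse {fib (2 + k)} {fib (3 + k)} {fib (suc k)}
        (*-mono-< (fib-suc>0 k) (fib-suc>0 (suc (suc k)))) (cassini (suc k)))
    where
    fib-suc>0 : ∀ m → 0 < fib (suc m)
    fib-suc>0 m with fib-suc≡suc m
    ... | t , eq = subst (0 <_) (sym eq) z<s

  2∣fib[6+m]⇒2∣fib[m] : ∀ m → 2 ∣ fib (6 + m) → 2 ∣ fib m
  2∣fib[6+m]⇒2∣fib[m] m 2∣f₆₊ₘ =
    ∣m+n∣m⇒∣n (subst (2 ∣_) (trans (fib-+ 5 m) (identity (fib (suc m)) (fib m))) 2∣f₆₊ₘ)
              (n∣m*n (4 * fib (suc m) + 2 * fib m))
    where
    identity : ∀ y x → 8 * y + 5 * x ≡ (4 * y + 2 * x) * 2 + x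
    identity = solve-∀

module FibonacciSquares where
  open import Data.Nat
  open import Data.Nat.Properties
  open import Data.Nat.DivMod using (_/_; m*n/n≡m)
  open import Data.Nat.Divisibility using (_∣_; _∣?_; divides)
  open import Data.Nat.Tactic.RingSolver using (solve)
  open import Data.Empty using (⊥-elim)
  open import Relation.Nullary.Decidable using (from-no)
  open import Data.Integer as ℤ using (ℤ; +_)
  import Data.Integer.Properties as ℤ
  import Data.Integer.Tactic.RingSolver as ℤ
  open ThreeGenerated
  open Fibonacci
  open ≡-Reasoning

  frobeniusFormula : ℕ → ℕ → ℕ → ℤ
  frobeniusFormula n x y = (+ x ℤ.- + 1) ℤ.* (+ fib (n + 1) ℤ.* + fib (n + 1))
                         ℤ.+ (+ y ℤ.- + 1) ℤ.* (+ fib (n + 2) ℤ.* + fib (n + 2))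
                         ℤ.- + fib n ℤ.* + fib n

  frobenius-of-S : ∀ n {p q r₁₂ r₂₁ r₂₃ r₃₁ r₃₂ x y F} →
    MinimalRelations (fib n * fib n) (fib (n + 1) * fib (n + 1)) (fib (n + 2) * fib (n + 2))
                     p q r₁₂ r₂₁ r₂₃ r₃₁ r₃₂ →
    x ≡ suc p → y ≡ suc q → IsFrobeniusNumber (S n) F → + F ≡ frobeniusFormula n x y
  frobenius-of-S n {p} {q} {F = F} R refl refl frob with fib-square-inverse n
  ... | u , v , inverse = begin
    + F                                                        ≡⟨ identity (+ F) (+ a ℤ.* + a) ⟩
    + F ℤ.+ + a ℤ.* + a ℤ.- + a ℤ.* + a                        ≡⟨ cong (λ X → X ℤ.- + a ℤ.* + a) casted ⟩
    + p ℤ.* (+ b ℤ.* + b) ℤ.+ + q ℤ.* (+ c ℤ.* + c) ℤ.- + a ℤ.* + a ∎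
    where
    a b c : ℕ
    a = fib n
    b = fib (n + 1)
    c = fib (n + 2)
    identity : ∀ F a² → F ≡ F ℤ.+ a² ℤ.- a²
    identity = ℤ.solve-∀
    pos-*² : ∀ k x → + (k * (x * x)) ≡ + k ℤ.* (+ x ℤ.* + x)
    pos-*² k x = trans (ℤ.pos-* k (x * x)) (cong (ℤ._*_ (+ k)) (ℤ.pos-* x x))
    casted : + F ℤ.+ + a ℤ.* + a ≡ + p ℤ.* (+ b ℤ.* + b) ℤ.+ + q ℤ.* (+ c ℤ.* + c)
    casted = begin
      + F ℤ.+ + a ℤ.* + a              ≡⟨ cong (ℤ._+_ (+ F)) (sym (ℤ.pos-* a a)) ⟩
      + (F + a * a)                    ≡⟨ cong +_ (frobenius-number R {u} {v} inverse frob) ⟩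
      + (p * (b * b) + q * (c * c))    ≡⟨ cong₂ ℤ._+_ (pos-*² p b) (pos-*² q c) ⟩
      + p ℤ.* (+ b ℤ.* + b) ℤ.+ + q ℤ.* (+ c ℤ.* + c) ∎

  x≡y*2⇒x/2≡y : ∀ {x y} → x ≡ y * 2 → x / 2 ≡ y
  x≡y*2⇒x/2≡y {y = y} x≡y*2 = trans (cong (_/ 2) x≡y*2) (m*n/n≡m y 2)

  m+d≡n⇒m≤n : ∀ {m n} d → m + d ≡ n → m ≤ n
  m+d≡n⇒m≤n {m} d refl = m≤m+n m d

  -- With fₘ = 2w and fₘ₊₁ = 1 + t, the generators are fₘ₊ₖ = fₖ (1 + t) + fₖ₋₁ 2w; the
  -- inequalities are certified by their slack, a polynomial with nonnegative coefficients.
  relations-fₙ-even : ∀ {a b c} w t →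
    a ≡ 8 * suc t + 5 * (w * 2) → b ≡ 13 * suc t + 8 * (w * 2) → c ≡ 21 * suc t + 13 * (w * 2) →
    MinimalRelations (a * a) (b * b) (c * c) (16 + 17 * t + 21 * w) (2 + 3 * t + 4 * w)
      (13 * suc t + 16 * w) (38 * suc t + 47 * w) (suc t + w) (17 * suc t + 21 * w) (4 * suc t + 5 * w)
  relations-fₙ-even w t refl refl refl = record
    { c₂-split    = solve (w ∷ t ∷ [])
    ; relation₂   = solve (w ∷ t ∷ [])
    ; relation₃   = solve (w ∷ t ∷ [])
    ; determinant = solve (w ∷ t ∷ [])
    ; A>0         = z<s
    ; r₂₁>0       = z<s
    ; r₃₁>0       = z<s
    ; r₃₂c₃≤2A    = m+d≡n⇒m≤n (7 * ((4 * suc t + 5 * w) * (4 * suc t + 5 * w))) (solve (w ∷ t ∷ []))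
    ; r₂₃C≤r₃₂B   = m+d≡n⇒m≤n
        (235 * suc t * suc t * suc t + 976 * suc t * suc t * w + 1336 * suc t * w * w + 604 * w * w * w)
        (solve (w ∷ t ∷ []))
    }

  relations-fₙ₊₁-even : ∀ {a b c} w t →
    a ≡ 5 * suc t + 3 * (w * 2) → b ≡ 8 * suc t + 5 * (w * 2) → c ≡ 13 * suc t + 8 * (w * 2) →
    MinimalRelations (a * a) (b * b) (c * c) (12 + 13 * t + 16 * w) (t + w)
      (4 * suc t + 5 * w) (13 * suc t + 16 * w) (3 * suc t + 4 * w) (4 * suc t + 5 * w) (9 * suc t + 11 * w)
  relations-fₙ₊₁-even w t refl refl refl = record
    { c₂-split    = solve (w ∷ t ∷ [])
    ; relation₂   = solve (w ∷ t ∷ [])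
    ; relation₃   = solve (w ∷ t ∷ [])
    ; determinant = solve (w ∷ t ∷ [])
    ; A>0         = z<s
    ; r₂₁>0       = z<s
    ; r₃₁>0       = z<s
    ; r₃₂c₃≤2A    = m+d≡n⇒m≤n ((14 * suc t + 17 * w) * (suc t + w)) (solve (w ∷ t ∷ []))
    ; r₂₃C≤r₃₂B   = m+d≡n⇒m≤n
        (69 * suc t * suc t * suc t + 220 * suc t * suc t * w + 228 * suc t * w * w + 76 * w * w * w)
        (solve (w ∷ t ∷ []))
    }

  relations-fₙ₊₂-even : ∀ {a b c} w t →
    a ≡ 3 * suc t + 2 * (w * 2) → b ≡ 5 * suc t + 3 * (w * 2) → c ≡ 8 * suc t + 5 * (w * 2) →
    MinimalRelations (a * a) (b * b) (c * c) (3 + 4 * t + 5 * w) (1 + 2 * t + 3 * w)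
      (suc t + w) (4 * suc t + 5 * w) (suc t + w) (13 * suc t + 16 * w) (3 * suc t + 4 * w)
  relations-fₙ₊₂-even w t refl refl refl = record
    { c₂-split    = solve (w ∷ t ∷ [])
    ; relation₂   = solve (w ∷ t ∷ [])
    ; relation₃   = solve (w ∷ t ∷ [])
    ; determinant = solve (w ∷ t ∷ [])
    ; A>0         = z<s
    ; r₂₁>0       = z<s
    ; r₃₁>0       = z<s
    ; r₃₂c₃≤2A    = m+d≡n⇒m≤n ((3 * suc t + 4 * w) * (3 * suc t + 4 * w)) (solve (w ∷ t ∷ []))
    ; r₂₃C≤r₃₂B   = m+d≡n⇒m≤n
        (11 * suc t * suc t * suc t + 56 * suc t * suc t * w + 88 * suc t * w * w + 44 * w * w * w)
        (solve (w ∷ t ∷ []))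
    }

  module _ {m w t : ℕ} (fₘ≡2w : fib m ≡ w * 2) (fₘ₊₁≡1+t : fib (suc m) ≡ suc t) where

    fib-shift : ∀ k → fib (suc k + m) ≡ fib (suc k) * suc t + fib k * (w * 2)
    fib-shift k = trans (fib-+ k m) (cong₂ (λ x y → fib (suc k) * x + fib k * y) fₘ₊₁≡1+t fₘ≡2w)

    fib-shift⊕ : ∀ k j → fib (suc k + m + j) ≡ fib (suc (k + j)) * suc t + fib (k + j) * (w * 2)
    fib-shift⊕ k j = trans (cong fib reassociate) (fib-shift (k + j))
      where
      reassociate : suc k + m + j ≡ suc (k + j) + m
      reassociate = solve (k ∷ j ∷ m ∷ [])

    frobenius-fₙ-even : ∀ {F} → IsFrobeniusNumber (S (6 + m)) F →
      + F ≡ frobeniusFormula (6 + m) (fib (6 + m + 3) / 2) (fib (6 + m ∸ 2))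
    frobenius-fₙ-even = frobenius-of-S (6 + m)
      (relations-fₙ-even w t (fib-shift 5) (fib-shift⊕ 5 1) (fib-shift⊕ 5 2))
      (x≡y*2⇒x/2≡y (begin
        fib (6 + m + 3)                  ≡⟨ fib-shift⊕ 5 3 ⟩
        34 * suc t + 21 * (w * 2)        ≡⟨ solve (w ∷ t ∷ []) ⟩
        suc (16 + 17 * t + 21 * w) * 2   ∎))
      (begin
        fib (6 + m ∸ 2)                  ≡⟨ fib-shift 3 ⟩
        3 * suc t + 2 * (w * 2)          ≡⟨ solve (w ∷ t ∷ []) ⟩
        suc (2 + 3 * t + 4 * w)          ∎)

    frobenius-fₙ₊₁-even : ∀ {F} → IsFrobeniusNumber (S (5 + m)) F →
      + F ≡ frobeniusFormula (5 + m) (fib (5 + m + 2)) (fib (5 + m ∸ 2) / 2)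
    frobenius-fₙ₊₁-even = frobenius-of-S (5 + m)
      (relations-fₙ₊₁-even w t (fib-shift 4) (fib-shift⊕ 4 1) (fib-shift⊕ 4 2))
      (begin
        fib (5 + m + 2)                  ≡⟨ fib-shift⊕ 4 2 ⟩
        13 * suc t + 8 * (w * 2)         ≡⟨ solve (w ∷ t ∷ []) ⟩
        suc (12 + 13 * t + 16 * w)       ∎)
      (x≡y*2⇒x/2≡y (begin
        fib (5 + m ∸ 2)                  ≡⟨ fib-shift 2 ⟩
        2 * suc t + 1 * (w * 2)          ≡⟨ solve (w ∷ t ∷ []) ⟩
        suc (t + w) * 2                  ∎))

    frobenius-fₙ₊₂-even : ∀ {F} → IsFrobeniusNumber (S (4 + m)) F →
      + F ≡ frobeniusFormula (4 + m) (fib (4 + m + 2) / 2) ((fib (4 + m ∸ 2) + fib (4 + m)) / 2)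
    frobenius-fₙ₊₂-even = frobenius-of-S (4 + m)
      (relations-fₙ₊₂-even w t (fib-shift 3) (fib-shift⊕ 3 1) (fib-shift⊕ 3 2))
      (x≡y*2⇒x/2≡y (begin
        fib (4 + m + 2)                  ≡⟨ fib-shift⊕ 3 2 ⟩
        8 * suc t + 5 * (w * 2)          ≡⟨ solve (w ∷ t ∷ []) ⟩
        suc (3 + 4 * t + 5 * w) * 2      ∎))
      (x≡y*2⇒x/2≡y (begin
        fib (4 + m ∸ 2) + fib (4 + m)                      ≡⟨ cong₂ _+_ (fib-shift 1) (fib-shift 3) ⟩
        1 * suc t + 1 * (w * 2) + (3 * suc t + 2 * (w * 2)) ≡⟨ solve (w ∷ t ∷ []) ⟩
        suc (1 + 2 * t + 3 * w) * 2                        ∎))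

  frobenius-when-2∣fₙ : ∀ m {F} → IsFrobeniusNumber (S (4 + m)) F → 2 ∣ fib (4 + m) →
    + F ≡ frobeniusFormula (4 + m) (fib (4 + m + 3) / 2) (fib (4 + m ∸ 2))
  frobenius-when-2∣fₙ 0 _ 2∣3 = ⊥-elim (from-no (2 ∣? 3) 2∣3)
  frobenius-when-2∣fₙ 1 _ 2∣5 = ⊥-elim (from-no (2 ∣? 5) 2∣5)
  frobenius-when-2∣fₙ (suc (suc m)) frob 2∣fₙ =
    let divides w fₘ≡2w = 2∣fib[6+m]⇒2∣fib[m] m 2∣fₙ
        t , fₘ₊₁≡1+t = fib-suc≡suc m
    in frobenius-fₙ-even {m} {w} {t} fₘ≡2w fₘ₊₁≡1+t frob

  frobenius-when-2∣fₙ₊₁ : ∀ m {F} → IsFrobeniusNumber (S (4 + m)) F → 2 ∣ fib (4 + m + 1) →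
    + F ≡ frobeniusFormula (4 + m) (fib (4 + m + 2)) (fib (4 + m ∸ 2) / 2)
  frobenius-when-2∣fₙ₊₁ 0 _ 2∣5 = ⊥-elim (from-no (2 ∣? 5) 2∣5)
  frobenius-when-2∣fₙ₊₁ (suc m) frob 2∣fₙ₊₁ =
    let divides w fₘ≡2w = 2∣fib[6+m]⇒2∣fib[m] m (subst (2 ∣_) (cong fib (+-comm (5 + m) 1)) 2∣fₙ₊₁)
        t , fₘ₊₁≡1+t = fib-suc≡suc m
    in frobenius-fₙ₊₁-even {m} {w} {t} fₘ≡2w fₘ₊₁≡1+t frob

  frobenius-when-2∣fₙ₊₂ : ∀ m {F} → IsFrobeniusNumber (S (4 + m)) F → 2 ∣ fib (4 + m + 2) →
    + F ≡ frobeniusFormula (4 + m) (fib (4 + m + 2) / 2) ((fib (4 + m ∸ 2) + fib (4 + m)) / 2)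
  frobenius-when-2∣fₙ₊₂ m frob 2∣fₙ₊₂ =
    let divides w fₘ≡2w = 2∣fib[6+m]⇒2∣fib[m] m (subst (2 ∣_) (cong fib (+-comm (4 + m) 2)) 2∣fₙ₊₂)
        t , fₘ₊₁≡1+t = fib-suc≡suc m
    in frobenius-fₙ₊₂-even {m} {w} {t} fₘ≡2w fₘ₊₁≡1+t frob

open FibonacciSquares
open import Data.Nat using (ℕ; _≤_; _∸_; s≤s; z≤n) renaming (_+_ to _⊕_)
open import Data.Nat.Divisibility using (_∣_)
open import Data.Nat.DivMod using (_/_)
open import Data.Integer using (ℤ; +_; _+_; _-_; _*_)

corollary5p16 : ∀ (n : ℕ) → 4 ≤ n → ∀ (F : ℕ) → IsFrobeniusNumber (S n) F →
    ((2 ∣ fib n → + F ≡ (+ (fib (n ⊕ 3) / 2) - + 1) * (+ fib (n ⊕ 1) * + fib (n ⊕ 1))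
                         + (+ fib (n ∸ 2) - + 1) * (+ fib (n ⊕ 2) * + fib (n ⊕ 2))
                         - + fib n * + fib n)
    × (2 ∣ fib (n ⊕ 1) → + F ≡ (+ fib (n ⊕ 2) - + 1) * (+ fib (n ⊕ 1) * + fib (n ⊕ 1))
                         + (+ (fib (n ∸ 2) / 2) - + 1) * (+ fib (n ⊕ 2) * + fib (n ⊕ 2))
                         - + fib n * + fib n)
    × (2 ∣ fib (n ⊕ 2) → + F ≡ (+ (fib (n ⊕ 2) / 2) - + 1) * (+ fib (n ⊕ 1) * + fib (n ⊕ 1))
                         + (+ ((fib (n ∸ 2) ⊕ fib n) / 2) - + 1) * (+ fib (n ⊕ 2) * + fib (n ⊕ 2))
                         - + fib n * + fib n))
corollary5p16 _ (s≤s (s≤s (s≤s (s≤s {n = m} z≤n)))) F frob =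
  frobenius-when-2∣fₙ m frob , frobenius-when-2∣fₙ₊₁ m frob , frobenius-when-2∣fₙ₊₂ m frob
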